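{- Let $S$ be a set, $q$ a prime, $f : S \to \mathbb{Z}_q$ any map, and $c_1, c_2, \lambda_1, \lambda_2, \mu_1, \mu_2 \in \mathbb{Z}$. If $|S|\, q^2\, q! < (q-1)^q$, then there exist maps $\alpha : \mathbb{Z}_q \to \mathbb{Z}_q$ and $\beta_s : \mathbb{Z}_q \to \mathbb{Z}_q$ for each $s \in S$ such that \[\alpha(x)\beta_s(y) + (\alpha(x) + c_1x)(\beta_s(y) + c_2y) + \lambda_1\alpha(x) + \mu_1 x + \lambda_2\beta_s(y) + \mu_2 y + f(s) \neq 0\] for all $x, y \in \mathbb{Z}_q$ and all $s \in S$. -}

module Defs where

open import Data.Nat as ℕ using (ℕ)
open import Data.Fin using (Fin; toℕ)
open import Data.Integer using (ℤ; +_; _+_; _*_)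

-- Elements of ℤ_q are represented by Fin q (residues 0..q-1);
-- ι embeds a residue into ℤ as its canonical representative.
ι : {q : ℕ} → Fin q → ℤ
ι a = + toℕ a

-- The integer expression of Lemma 6, evaluated on integer representatives
-- a = α(x), b = β_s(y), x, y, and fs = f(s).  Its class mod q is the
-- ℤ_q-value of the expression in the paper.
expr : (c₁ c₂ λ₁ λ₂ μ₁ μ₂ : ℤ) (a b x y fs : ℤ) → ℤ
expr c₁ c₂ λ₁ λ₂ μ₁ μ₂ a b x y fs =
  a * b + (a + c₁ * x) * (b + c₂ * y) + λ₁ * a + μ₁ * x + λ₂ * b + μ₂ * y + fs

module Submission where

-- Doubling the expression E gives 2E = U·V + (A x + B), where U = 2α(x) + c₁x + λ₂,
-- V = 2β_s(y) + c₂y + λ₁ and A, B depend only on y and f(s).  As q is odd, α can be chosen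
-- with U ≡ σ(x) for a fixed sign pattern σ : ℤ_q → {±1}; then, for fixed s and y, E vanishes
-- at x exactly when V ≡ κ(x) := −σ(x)(A x + B).  For q ≥ 7 the pattern σ makes κ non-injective,
-- so κ misses some residue t, and β_s(y) is chosen with V ≡ t.  The hypothesis on |S| only
-- excludes the primes q < 7 (when S is nonempty).

open import Defs
open import Data.Empty using (⊥-elim)
open import Data.Fin using (Fin; toℕ; fromℕ; fromℕ<; inject₁; punchOut; suc)
open import Data.Fin.Patterns using (0F; 1F; 2F; 3F)
open import Data.Fin.Properties
  using (toℕ-injective; toℕ<n; toℕ-fromℕ; toℕ-fromℕ<; toℕ-inject₁; _≟_; any?; all?; ¬∀⟶∃¬;
         punchOut-injective; <⇒notInjective)
open import Data.Integer using (ℤ; +_; _+_; _*_; _-_; -_; ∣_∣; _⊖_; _◃_; 0ℤ; -1ℤ)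
open import Data.Integer.DivMod using (_%ℕ_; _/ℕ_; n%ℕd<d; a≡a%ℕn+[a/ℕn]*n)
open import Data.Integer.Divisibility using (_∣_)
import Data.Integer.Divisibility.Signed as Signed
open import Data.Integer.Properties
  using (+-injective; i-j≡0⇒i≡j; ∣i∣≡0⇒i≡0; [+m]-[+n]≡m⊖n; ∣m⊝n∣≤m⊔n; +-identityʳ; +-inverseʳ;
         abs-*)
open import Data.Integer.Tactic.RingSolver using (solve-∀)
open import Data.Nat as ℕ using (ℕ; _∸_; _^_; _<_; _!; s≤s; z≤n)
import Data.Nat.Divisibility as ℕ
import Data.Nat.Properties as ℕ
open import Data.Nat.Primality using (Prime; prime⇒nonZero; euclidsLemma; ¬prime[0])
open import Data.Product using (Σ; ∃; ∃₂; _×_; _,_; proj₁; proj₂)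
open import Data.Sign as Sign using (Sign)
open import Data.Sum using ([_,_]′)
open import Function using (_∘_; id)
open import Function.Definitions using (Injective)
open import Level using (0ℓ)
open import Relation.Binary.Bundles using (Setoid)
open import Relation.Binary.PropositionalEquality
import Relation.Binary.Reasoning.Setoid as SetoidReasoning
open import Relation.Nullary using (¬_; Dec; yes; no; contradiction)
import Relation.Nullary.Decidable as Dec
open import Relation.Nullary.Decidable using (True; toWitness)

injective⇒surjective : ∀ {n} {g : Fin n → Fin n} → Injective _≡_ _≡_ g → ∀ t → ∃ λ x → g x ≡ t
injective⇒surjective {ℕ.suc m} {g} g-injective t with any? (λ x → g x ≟ t)
... | yes hit  = hit
... | no  miss = ⊥-elim (<⇒notInjective (ℕ.n<1+n m) g′-injective)
  where
  t≢g : ∀ x → t ≢ g x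
  t≢g x t≡gx = miss (x , sym t≡gx)
  g′ : Fin (ℕ.suc m) → Fin m
  g′ x = punchOut (t≢g x)
  g′-injective : Injective _≡_ _≡_ g′
  g′-injective = g-injective ∘ punchOut-injective (t≢g _) (t≢g _)

collision⇒missesValue : ∀ {n} (g : Fin n → Fin n) {x₁ x₂} → x₁ ≢ x₂ → g x₁ ≡ g x₂ →
                        ∃ λ t → ∀ x → g x ≢ t
collision⇒missesValue {n} g {x₁} {x₂} x₁≢x₂ gx₁≡gx₂ with all? (λ t → any? (λ x → g x ≟ t))
... | no ¬onto = let t , unhit = ¬∀⟶∃¬ n _ (λ t → any? (λ x → g x ≟ t)) ¬onto in
                 t , λ x gx≡t → unhit (x , gx≡t)
... | yes onto = contradiction x₁≡x₂ x₁≢x₂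
  where
  h : Fin n → Fin n
  h t = proj₁ (onto t)
  h-injective : Injective _≡_ _≡_ h
  h-injective {t} {t′} ht≡ht′ = begin
    t           ≡⟨ proj₂ (onto t) ⟨
    g (h t)     ≡⟨ cong g ht≡ht′ ⟩
    g (h t′)    ≡⟨ proj₂ (onto t′) ⟩
    t′          ∎
    where open ≡-Reasoning
  h∘g : ∀ x → h (g x) ≡ x
  h∘g x with t , ht≡x ← injective⇒surjective h-injective x = begin
    h (g x)       ≡⟨ cong (h ∘ g) ht≡x ⟨
    h (g (h t))   ≡⟨ cong h (proj₂ (onto t)) ⟩
    h t           ≡⟨ ht≡x ⟩
    x             ∎
    where open ≡-Reasoning
  x₁≡x₂ : x₁ ≡ x₂
  x₁≡x₂ = trans (sym (h∘g x₁)) (trans (cong h gx₁≡gx₂) (h∘g x₂))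

◃1-involutive : ∀ σ v → (σ ◃ 1) * ((σ ◃ 1) * v) ≡ v
◃1-involutive Sign.+ = lemma
  where
  lemma : ∀ v → + 1 * (+ 1 * v) ≡ v
  lemma = solve-∀
◃1-involutive Sign.- = lemma
  where
  lemma : ∀ v → -1ℤ * (-1ℤ * v) ≡ v
  lemma = solve-∀

module Modulo (q : ℕ) .{{_ : ℕ.NonZero q}} where

  infix 4 _≈_ _≉_ _≈?_

  record _≈_ (a b : ℤ) : Set where
    constructor q∣-
    field q∣a-b : + q Signed.∣ a - b

  open _≈_ public

  _≉_ : ℤ → ℤ → Set
  a ≉ b = ¬ a ≈ b

  _≈?_ : ∀ a b → Dec (a ≈ b)
  a ≈? b = Dec.map′ q∣- q∣a-b (+ q Signed.∣? a - b)

  ∣⇒≈ : ∀ {a b d} → a - b ≡ d → + q Signed.∣ d → a ≈ b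
  ∣⇒≈ a-b≡d = q∣- ∘ subst (+ q Signed.∣_) (sym a-b≡d)

  ∣⇒≈0 : ∀ {a} → + q Signed.∣ a → a ≈ 0ℤ
  ∣⇒≈0 {a} = ∣⇒≈ (+-identityʳ a)

  q≈0 : + q ≈ 0ℤ
  q≈0 = ∣⇒≈0 Signed.∣-refl

  ≈-refl : ∀ {a} → a ≈ a
  ≈-refl {a} = q∣- (Signed.divides 0ℤ (+-inverseʳ a))

  ≈-sym : ∀ {a b} → a ≈ b → b ≈ a
  ≈-sym {a} {b} = ∣⇒≈ (lemma a b) ∘ Signed.∣m⇒∣-m ∘ q∣a-b
    where
    lemma : ∀ a b → b - a ≡ - (a - b)
    lemma = solve-∀

  ≈-trans : ∀ {a b c} → a ≈ b → b ≈ c → a ≈ c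
  ≈-trans {a} {b} {c} a≈b b≈c = ∣⇒≈ (lemma a b c) (Signed.∣m∣n⇒∣m+n (q∣a-b a≈b) (q∣a-b b≈c))
    where
    lemma : ∀ a b c → a - c ≡ (a - b) + (b - c)
    lemma = solve-∀

  ≈-setoid : Setoid 0ℓ 0ℓ
  ≈-setoid = record
    { Carrier       = ℤ
    ; _≈_           = _≈_
    ; isEquivalence = record { refl = ≈-refl ; sym = ≈-sym ; trans = ≈-trans }
    }

  module ≈-Reasoning = SetoidReasoning ≈-setoid

  +-congˡ : ∀ c {a b} → a ≈ b → c + a ≈ c + b
  +-congˡ c {a} {b} = ∣⇒≈ (lemma c a b) ∘ q∣a-b
    where
    lemma : ∀ c a b → (c + a) - (c + b) ≡ a - b
    lemma = solve-∀

  +-congʳ : ∀ c {a b} → a ≈ b → a + c ≈ b + c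
  +-congʳ c {a} {b} = ∣⇒≈ (lemma c a b) ∘ q∣a-b
    where
    lemma : ∀ c a b → (a + c) - (b + c) ≡ a - b
    lemma = solve-∀

  *-congˡ : ∀ c {a b} → a ≈ b → c * a ≈ c * b
  *-congˡ c {a} {b} = ∣⇒≈ (lemma c a b) ∘ Signed.∣n⇒∣m*n c ∘ q∣a-b
    where
    lemma : ∀ c a b → c * a - c * b ≡ c * (a - b)
    lemma = solve-∀

  *-congʳ : ∀ c {a b} → a ≈ b → a * c ≈ b * c
  *-congʳ c {a} {b} = ∣⇒≈ (lemma c a b) ∘ Signed.∣n⇒∣m*n c ∘ q∣a-b
    where
    lemma : ∀ c a b → a * c - b * c ≡ c * (a - b)
    lemma = solve-∀

  +-cancelʳ : ∀ c {a b} → a + c ≈ b + c → a ≈ b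
  +-cancelʳ c {a} {b} = ∣⇒≈ (lemma c a b) ∘ q∣a-b
    where
    lemma : ∀ c a b → a - b ≡ (a + c) - (b + c)
    lemma = solve-∀

  residue : ℤ → Fin q
  residue i = fromℕ< (n%ℕd<d i q)

  ≈-residue : ∀ i → i ≈ ι (residue i)
  ≈-residue i = q∣- (Signed.divides (i /ℕ q) (begin
    i - ι (residue i)                           ≡⟨ cong (λ k → i - + k) (toℕ-fromℕ< (n%ℕd<d i q)) ⟩
    i - + (i %ℕ q)                              ≡⟨ cong (_- + (i %ℕ q)) (a≡a%ℕn+[a/ℕn]*n i q) ⟩
    (+ (i %ℕ q) + (i /ℕ q) * + q) - + (i %ℕ q)  ≡⟨ lemma (+ (i %ℕ q)) ((i /ℕ q) * + q) ⟩
    (i /ℕ q) * + q                              ∎))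
    where
    open ≡-Reasoning
    lemma : ∀ m k → (m + k) - m ≡ k
    lemma = solve-∀

  ∣∧<⇒≡0 : ∀ {m} → q ℕ.∣ m → m < q → m ≡ 0
  ∣∧<⇒≡0 {ℕ.zero}  _   _   = refl
  ∣∧<⇒≡0 {ℕ.suc m} q∣m m<q = contradiction q∣m (ℕ.>⇒∤ m<q)

  ι-injective : ∀ {a b : Fin q} → ι a ≈ ι b → a ≡ b
  ι-injective {a} {b} (q∣- q∣a-b) = toℕ-injective (+-injective (i-j≡0⇒i≡j (ι a) (ι b) a-b≡0))
    where
    open ℕ.≤-Reasoning
    ∣a-b∣<q : ∣ ι a - ι b ∣ < q
    ∣a-b∣<q = begin-strict
      ∣ ι a - ι b ∣      ≡⟨ cong ∣_∣ ([+m]-[+n]≡m⊖n (toℕ a) (toℕ b)) ⟩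
      ∣ toℕ a ⊖ toℕ b ∣  ≤⟨ ∣m⊝n∣≤m⊔n (toℕ a) (toℕ b) ⟩
      toℕ a ℕ.⊔ toℕ b    <⟨ ℕ.⊔-pres-<m (toℕ<n a) (toℕ<n b) ⟩
      q                  ∎
    a-b≡0 : ι a - ι b ≡ 0ℤ
    a-b≡0 = ∣i∣≡0⇒i≡0 (∣∧<⇒≡0 (Signed.∣⇒∣ᵤ q∣a-b) ∣a-b∣<q)

  residue-injective : ∀ {i j} → residue i ≡ residue j → i ≈ j
  residue-injective {i} {j} eq = begin
    i              ≈⟨ ≈-residue i ⟩
    ι (residue i)  ≡⟨ cong ι eq ⟩
    ι (residue j)  ≈⟨ ≈-residue j ⟨
    j              ∎
    where open ≈-Reasoning

  residue-cong : ∀ {i j} → i ≈ j → residue i ≡ residue j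
  residue-cong {i} {j} i≈j = ι-injective (begin
    ι (residue i)  ≈⟨ ≈-residue i ⟨
    i              ≈⟨ i≈j ⟩
    j              ≈⟨ ≈-residue j ⟩
    ι (residue j)  ∎)
    where open ≈-Reasoning

module PrimeModulo (q : ℕ) (q-prime : Prime q) where

  private
    instance
      q-nonZero : ℕ.NonZero q
      q-nonZero = prime⇒nonZero q-prime

  open Modulo q public

  *-cancelˡ : ∀ {c a b} → c ≉ 0ℤ → c * a ≈ c * b → a ≈ b
  *-cancelˡ {c} {a} {b} c≉0 (q∣- q∣ca-cb) =
    [ (λ q∣c → contradiction (∣⇒≈0 (Signed.∣ᵤ⇒∣ q∣c)) c≉0) , q∣- ∘ Signed.∣ᵤ⇒∣ ]′
      (euclidsLemma ∣ c ∣ ∣ a - b ∣ q-prime q∣∣c∣∣a-b∣)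
    where
    lemma : ∀ c a b → c * a - c * b ≡ c * (a - b)
    lemma = solve-∀
    q∣∣c∣∣a-b∣ : q ℕ.∣ ∣ c ∣ ℕ.* ∣ a - b ∣
    q∣∣c∣∣a-b∣ = subst (q ℕ.∣_) (abs-* c (a - b))
                   (Signed.∣⇒∣ᵤ (subst (+ q Signed.∣_) (lemma c a b) q∣ca-cb))

  affine-surjective : ∀ {a} → a ≉ 0ℤ → ∀ c t → ∃ λ (z : Fin q) → a * ι z + c ≈ t
  affine-surjective {a} a≉0 c t =
    let z , gz≡t = injective⇒surjective g-injective (residue t) in z , residue-injective gz≡t
    where
    g : Fin q → Fin q
    g z = residue (a * ι z + c)
    g-injective : Injective _≡_ _≡_ g
    g-injective = ι-injective ∘ *-cancelˡ a≉0 ∘ +-cancelʳ c ∘ residue-injective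

module SignPattern (r : ℕ) (q-prime : Prime (7 ℕ.+ r)) where

  open PrimeModulo (7 ℕ.+ r) q-prime

  -- {0, 1, 3} is symmetric about no point of ℤ_q once q ≥ 7, so every residue is the sum
  -- of a point where the sign is + and a point where it is −.
  sign : Fin (7 ℕ.+ r) → Sign
  sign 0F = Sign.+
  sign 1F = Sign.+
  sign 3F = Sign.+
  sign _  = Sign.-

  unit : Fin (7 ℕ.+ r) → ℤ
  unit x = sign x ◃ 1

  sign-split : ∀ (s : Fin (7 ℕ.+ r)) →
               ∃₂ λ x₁ x₂ → sign x₁ ≡ Sign.+ × sign x₂ ≡ Sign.- × ι x₁ + ι x₂ ≈ ι s
  sign-split 0F = 1F , fromℕ (6 ℕ.+ r) , refl , refl , (begin
    + 1 + ι (fromℕ (6 ℕ.+ r))  ≡⟨ cong (λ k → + (1 ℕ.+ k)) (toℕ-fromℕ (6 ℕ.+ r)) ⟩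
    + (7 ℕ.+ r)                ≈⟨ q≈0 ⟩
    0ℤ                         ∎)
    where open ≈-Reasoning
  sign-split 1F = 3F , inject₁ (fromℕ (5 ℕ.+ r)) , refl , refl , (begin
    + 3 + ι (inject₁ (fromℕ (5 ℕ.+ r)))
      ≡⟨ cong (λ k → + (3 ℕ.+ k)) (trans (toℕ-inject₁ _) (toℕ-fromℕ (5 ℕ.+ r))) ⟩
    + 1 + + (7 ℕ.+ r)
      ≈⟨ +-congˡ (+ 1) q≈0 ⟩
    + 1
      ∎)
    where open ≈-Reasoning
  sign-split 2F = 0F , 2F , refl , refl , ≈-refl
  sign-split 3F = 1F , 2F , refl , refl , ≈-refl
  sign-split s@(suc (suc (suc (suc _)))) = 0F , s , refl , refl , ≈-refl

  opposite-signs⇒≢ : ∀ {x₁ x₂} → sign x₁ ≡ Sign.+ → sign x₂ ≡ Sign.- → x₁ ≢ x₂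
  opposite-signs⇒≢ x₁⁺ x₂⁻ refl with () ← trans (sym x₁⁺) x₂⁻

  forbidden : ℤ → ℤ → Fin (7 ℕ.+ r) → ℤ
  forbidden a c x = - (unit x * (a * ι x + c))

  forbidden-opposite : ∀ a c {x₁ x₂} → sign x₁ ≡ Sign.+ → sign x₂ ≡ Sign.- →
                       forbidden a c x₂ ≡ forbidden a c x₁ + (a * (ι x₁ + ι x₂) + + 2 * c)
  forbidden-opposite a c {x₁} {x₂} x₁⁺ x₂⁻ rewrite x₁⁺ | x₂⁻ = lemma a c (ι x₁) (ι x₂)
    where
    lemma : ∀ a c u v → - (-1ℤ * (a * v + c)) ≡ - (+ 1 * (a * u + c)) + (a * (u + v) + + 2 * c)
    lemma = solve-∀

  forbidden-degenerate : ∀ {a} c → a ≈ 0ℤ → forbidden a c 0F ≈ forbidden a c 1F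
  forbidden-degenerate {a} c a≈0 = begin
    forbidden a c 0F       ≡⟨ lemma a c ⟩
    forbidden a c 1F + a   ≈⟨ +-congˡ (forbidden a c 1F) a≈0 ⟩
    forbidden a c 1F + 0ℤ  ≡⟨ +-identityʳ (forbidden a c 1F) ⟩
    forbidden a c 1F       ∎
    where
    open ≈-Reasoning
    lemma : ∀ a c → - (+ 1 * (a * + 0 + c)) ≡ - (+ 1 * (a * + 1 + c)) + a
    lemma = solve-∀

  forbidden-split : ∀ a c {s} → a * ι s + + 2 * c ≈ 0ℤ →
                    ∃₂ λ x₁ x₂ → x₁ ≢ x₂ × forbidden a c x₁ ≈ forbidden a c x₂
  forbidden-split a c {s} as+2c≈0 with x₁ , x₂ , x₁⁺ , x₂⁻ , x₁+x₂≈s ← sign-split s =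
    x₁ , x₂ , opposite-signs⇒≢ x₁⁺ x₂⁻ , ≈-sym (begin
      κ₂                                  ≡⟨ forbidden-opposite a c x₁⁺ x₂⁻ ⟩
      κ₁ + (a * (ι x₁ + ι x₂) + + 2 * c)  ≈⟨ +-congˡ κ₁ (+-congʳ (+ 2 * c) (*-congˡ a x₁+x₂≈s)) ⟩
      κ₁ + (a * ι s + + 2 * c)            ≈⟨ +-congˡ κ₁ as+2c≈0 ⟩
      κ₁ + 0ℤ                             ≡⟨ +-identityʳ κ₁ ⟩
      κ₁                                  ∎)
    where
    open ≈-Reasoning
    κ₁ κ₂ : ℤ
    κ₁ = forbidden a c x₁
    κ₂ = forbidden a c x₂

  forbidden-collision : ∀ a c → ∃₂ λ x₁ x₂ → x₁ ≢ x₂ × forbidden a c x₁ ≈ forbidden a c x₂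
  forbidden-collision a c with a ≈? 0ℤ
  ... | yes a≈0 = 0F , 1F , (λ ()) , forbidden-degenerate c a≈0
  ... | no  a≉0 = forbidden-split a c (proj₂ (affine-surjective a≉0 (+ 2 * c) 0ℤ))

module Construction (r : ℕ) (q-prime : Prime (7 ℕ.+ r)) (c₁ c₂ λ₁ λ₂ μ₁ μ₂ : ℤ) where

  open PrimeModulo (7 ℕ.+ r) q-prime
  open SignPattern r q-prime

  slope : ℤ → ℤ
  slope y = c₁ * c₂ * y + (+ 2 * μ₁ - c₁ * λ₁)

  offset : ℤ → ℤ → ℤ
  offset y fs = (+ 2 * μ₂ - c₂ * λ₂) * y + + 2 * fs - λ₁ * λ₂

  expr-factorisation : ∀ a b x y fs →
    + 2 * expr c₁ c₂ λ₁ λ₂ μ₁ μ₂ a b x y fs ≡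
    (+ 2 * a + (c₁ * x + λ₂)) * (+ 2 * b + (c₂ * y + λ₁)) + (slope y * x + offset y fs)
  expr-factorisation = lemma c₁ c₂ λ₁ λ₂ μ₁ μ₂
    where
    lemma : ∀ c₁ c₂ λ₁ λ₂ μ₁ μ₂ a b x y fs →
      + 2 * (a * b + (a + c₁ * x) * (b + c₂ * y) + λ₁ * a + μ₁ * x + λ₂ * b + μ₂ * y + fs) ≡
      (+ 2 * a + (c₁ * x + λ₂)) * (+ 2 * b + (c₂ * y + λ₁)) +
      ((c₁ * c₂ * y + (+ 2 * μ₁ - c₁ * λ₁)) * x + ((+ 2 * μ₂ - c₂ * λ₂) * y + + 2 * fs - λ₁ * λ₂))
    lemma = solve-∀

  2≉0 : + 2 ≉ 0ℤ
  2≉0 (q∣- q∣2) = ℕ.>⇒∤ (s≤s (s≤s (s≤s z≤n))) (Signed.∣⇒∣ᵤ q∣2)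

  α-spec : ∀ x → ∃ λ (a : Fin (7 ℕ.+ r)) → + 2 * ι a + (c₁ * ι x + λ₂) ≈ unit x
  α-spec x = affine-surjective 2≉0 (c₁ * ι x + λ₂) (unit x)

  α : Fin (7 ℕ.+ r) → Fin (7 ℕ.+ r)
  α = proj₁ ∘ α-spec

  forbidden-at : ℤ → ℤ → Fin (7 ℕ.+ r) → ℤ
  forbidden-at y fs = forbidden (slope y) (offset y fs)

  vanishing⇒forbidden : ∀ x b y fs → expr c₁ c₂ λ₁ λ₂ μ₁ μ₂ (ι (α x)) b (ι x) y fs ≈ 0ℤ →
                        + 2 * b + (c₂ * y + λ₁) ≈ forbidden-at y fs x
  vanishing⇒forbidden x b y fs E≈0 = begin
    V                    ≡⟨ ◃1-involutive (sign x) V ⟨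
    u * (u * V)          ≡⟨ cancel u V D ⟨
    u * (u * V + D) + κ  ≈⟨ +-congʳ κ (*-congˡ u (+-congʳ D (*-congʳ V U≈u))) ⟨
    u * (U * V + D) + κ  ≡⟨ cong (λ e → u * e + κ) (expr-factorisation (ι (α x)) b (ι x) y fs) ⟨
    u * (+ 2 * E) + κ    ≈⟨ +-congʳ κ (*-congˡ u (*-congˡ (+ 2) E≈0)) ⟩
    u * (+ 2 * 0ℤ) + κ   ≡⟨ annihilate u κ ⟩
    κ                    ∎
    where
    open ≈-Reasoning
    u U V D E κ : ℤ
    u = unit x
    U = + 2 * ι (α x) + (c₁ * ι x + λ₂)
    V = + 2 * b + (c₂ * y + λ₁)
    D = slope y * ι x + offset y fs
    E = expr c₁ c₂ λ₁ λ₂ μ₁ μ₂ (ι (α x)) b (ι x) y fs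
    κ = forbidden-at y fs x
    U≈u : U ≈ u
    U≈u = proj₂ (α-spec x)
    cancel : ∀ u v d → u * (u * v + d) + - (u * d) ≡ u * (u * v)
    cancel = solve-∀
    annihilate : ∀ u k → u * (+ 2 * 0ℤ) + k ≡ k
    annihilate = solve-∀

  missed⇒nonvanishing : ∀ y fs (t : Fin (7 ℕ.+ r)) → (∀ x → residue (forbidden-at y fs x) ≢ t) →
                        ∀ (b : Fin (7 ℕ.+ r)) → + 2 * ι b + (c₂ * y + λ₁) ≈ ι t →
                        ∀ x → expr c₁ c₂ λ₁ λ₂ μ₁ μ₂ (ι (α x)) (ι b) (ι x) y fs ≉ 0ℤ
  missed⇒nonvanishing y fs t t-missed b Vb≈t x E≈0 = t-missed x (ι-injective (begin
    ι (residue (forbidden-at y fs x))  ≈⟨ ≈-residue (forbidden-at y fs x) ⟨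
    forbidden-at y fs x                ≈⟨ vanishing⇒forbidden x (ι b) y fs E≈0 ⟨
    + 2 * ι b + (c₂ * y + λ₁)          ≈⟨ Vb≈t ⟩
    ι t                                ∎))
    where open ≈-Reasoning

  ∃nonvanishing : ∀ y fs →
    ∃ λ (b : Fin (7 ℕ.+ r)) → ∀ x → expr c₁ c₂ λ₁ λ₂ μ₁ μ₂ (ι (α x)) (ι b) (ι x) y fs ≉ 0ℤ
  ∃nonvanishing y fs =
    let x₁ , x₂ , x₁≢x₂ , κx₁≈κx₂ = forbidden-collision (slope y) (offset y fs)
        t , t-missed =
          collision⇒missesValue (residue ∘ forbidden-at y fs) x₁≢x₂ (residue-cong κx₁≈κx₂)
        b , Vb≈t = affine-surjective 2≉0 (c₂ * y + λ₁) (ι t)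
    in  b , missed⇒nonvanishing y fs t t-missed b Vb≈t

bound-unsatisfiable : ∀ q → {True ((q ∸ 1) ^ q ℕ.≤? q ^ 2 ℕ.* q !)} →
                      ∀ n → ¬ (ℕ.suc n ℕ.* q ^ 2 ℕ.* (q !) < (q ∸ 1) ^ q)
bound-unsatisfiable q {dominated} n bound =
  ℕ.<⇒≱ (ℕ.≤-<-trans q²q!≤bound bound) (toWitness dominated)
  where
  q²q!≤bound : q ^ 2 ℕ.* q ! ℕ.≤ ℕ.suc n ℕ.* q ^ 2 ℕ.* q !
  q²q!≤bound = ℕ.*-monoˡ-≤ (q !) (ℕ.m≤m+n (q ^ 2) (n ℕ.* q ^ 2))

bound⇒q≡7+r : ∀ n q → Prime q → ℕ.suc n ℕ.* q ^ 2 ℕ.* (q !) < (q ∸ 1) ^ q → ∃ λ r → q ≡ 7 ℕ.+ r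
bound⇒q≡7+r n 0 q-prime _     = contradiction q-prime ¬prime[0]
bound⇒q≡7+r n 1 _       bound = contradiction bound (bound-unsatisfiable 1 n)
bound⇒q≡7+r n 2 _       bound = contradiction bound (bound-unsatisfiable 2 n)
bound⇒q≡7+r n 3 _       bound = contradiction bound (bound-unsatisfiable 3 n)
bound⇒q≡7+r n 4 _       bound = contradiction bound (bound-unsatisfiable 4 n)
bound⇒q≡7+r n 5 _       bound = contradiction bound (bound-unsatisfiable 5 n)
bound⇒q≡7+r n 6 _       bound = contradiction bound (bound-unsatisfiable 6 n)
bound⇒q≡7+r n (ℕ.suc (ℕ.suc (ℕ.suc (ℕ.suc (ℕ.suc (ℕ.suc (ℕ.suc r))))))) _ _ = r , refl

lemma6 : (n q : ℕ) → Prime q → (f : Fin n → Fin q) → (c₁ c₂ λ₁ λ₂ μ₁ μ₂ : ℤ) →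
         n ℕ.* q ^ 2 ℕ.* (q !) < (q ∸ 1) ^ q →
         Σ (Fin q → Fin q) λ α → Σ (Fin n → Fin q → Fin q) λ β →
           (x y : Fin q) (s : Fin n) →
             ¬ ((+ q) ∣ expr c₁ c₂ λ₁ λ₂ μ₁ μ₂ (ι (α x)) (ι (β s y)) (ι x) (ι y) (ι (f s)))
lemma6 ℕ.zero q _ _ _ _ _ _ _ _ _ = id , (λ ()) , λ _ _ ()
lemma6 (ℕ.suc n) q q-prime f c₁ c₂ λ₁ λ₂ μ₁ μ₂ bound with bound⇒q≡7+r n q q-prime bound
... | r , refl =
  α , (λ s y → proj₁ (∃nonvanishing (ι y) (ι (f s)))) ,
  λ x y s q∣E → proj₂ (∃nonvanishing (ι y) (ι (f s))) x (∣⇒≈0 (Signed.∣ᵤ⇒∣ q∣E))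
  where
  open PrimeModulo (7 ℕ.+ r) q-prime using (∣⇒≈0)
  open Construction r q-prime c₁ c₂ λ₁ λ₂ μ₁ μ₂ using (α; ∃nonvanishing)
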